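{- For all formulas $A,B$ and every $E\in{\sf NNIL}({\sf par})$: if ${\sf AR}_{\sf par}\vdash A\rhd B$ then ${\sf AR}_{\sf par}\vdash(E\to A)\rhd(E\to B)$.
   Context: Language: $\wedge,\vee,\to,\bot$ over finite atoms ${\sf atom}={\sf var}\cup{\sf par}$ (disjoint variables and parameters); $\vdash$ is ${\sf IPC}$-derivability. ${\sf NNIL}$ is the least class containing atoms, $\bot,\top$, closed under $\wedge,\vee$, and containing $B\to C$ whenever $C\in{\sf NNIL}$ and $B$ is built from atoms, $\bot,\top$ by $\wedge,\vee$ only; ${\sf NNIL}({\sf par})$: the ${\sf NNIL}$ formulas whose atoms are all parameters. ${\sf AR}_{\sf par}$ derives $A\rhd B$ from: Ax ($A\rhd B$ whenever $\vdash A\to B$); ${\sf V}$: $(B\to C)\rhd\bigvee_{i=1}^{n+m}B[E_i]$ with $B=\bigwedge_{i=1}^n(E_i\to F_i)$, $C=\bigvee_{i=n+1}^{n+m}E_i$, $B[E]:=E$ if $E\in{\sf par}\cup\{\bot\}$ and $B\to E$ otherwise; rules Conj ($A\rhd B$, $A\rhd C$ / $A\rhd B\wedge C$), Cut ($A\rhd B$, $B\rhd C$ / $A\rhd C$), Disj ($B\rhd A$, $C\rhd A$ / $B\vee C\rhd A$), Mont$({\sf par})$ ($A\rhd B$ / $(p\to A)\rhd(p\to B)$ for $p\in{\sf par}$). -}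

module Defs where

open import Data.Nat using (ℕ)
open import Data.Fin using (Fin)
open import Data.List using (List; []; _∷_; map; _++_; foldr)
open import Data.List.Membership.Propositional using (_∈_)
open import Data.Product using (_×_; _,_; proj₁; proj₂)

module Language (nv np : ℕ) where

  infixr 6 _∧'_
  infixr 5 _∨'_
  infixr 4 _⇒_

  data Formula : Set where
    var  : Fin nv → Formula
    par  : Fin np → Formula
    ⊥'   : Formula
    ⊤'   : Formula
    _∧'_ : Formula → Formula → Formula
    _∨'_ : Formula → Formula → Formula
    _⇒_  : Formula → Formula → Formula


  Ctx : Set
  Ctx = List Formula

  infix 2 _⊢_
  data _⊢_ (Γ : Ctx) : Formula → Set where
    hyp   : ∀ {A} → A ∈ Γ → Γ ⊢ A
    ⊤I    : Γ ⊢ ⊤'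
    ⊥E    : ∀ {A} → Γ ⊢ ⊥' → Γ ⊢ A
    ∧I    : ∀ {A B} → Γ ⊢ A → Γ ⊢ B → Γ ⊢ A ∧' B
    ∧E₁   : ∀ {A B} → Γ ⊢ A ∧' B → Γ ⊢ A
    ∧E₂   : ∀ {A B} → Γ ⊢ A ∧' B → Γ ⊢ B
    ∨I₁   : ∀ {A B} → Γ ⊢ A → Γ ⊢ A ∨' B
    ∨I₂   : ∀ {A B} → Γ ⊢ B → Γ ⊢ A ∨' B
    ∨E    : ∀ {A B C} → Γ ⊢ A ∨' B → (A ∷ Γ) ⊢ C → (B ∷ Γ) ⊢ C → Γ ⊢ C
    ⇒I    : ∀ {A B} → (A ∷ Γ) ⊢ B → Γ ⊢ A ⇒ B
    ⇒E    : ∀ {A B} → Γ ⊢ A ⇒ B → Γ ⊢ A → Γ ⊢ B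

  IPC⊢ : Formula → Set
  IPC⊢ A = [] ⊢ A

  data ImpFree : Formula → Set where
    var  : ∀ x → ImpFree (var x)
    par  : ∀ p → ImpFree (par p)
    ⊥'   : ImpFree ⊥'
    ⊤'   : ImpFree ⊤'
    _∧'_ : ∀ {A B} → ImpFree A → ImpFree B → ImpFree (A ∧' B)
    _∨'_ : ∀ {A B} → ImpFree A → ImpFree B → ImpFree (A ∨' B)

  data ParOnly : Formula → Set where
    par  : ∀ p → ParOnly (par p)
    ⊥'   : ParOnly ⊥'
    ⊤'   : ParOnly ⊤'
    _∧'_ : ∀ {A B} → ParOnly A → ParOnly B → ParOnly (A ∧' B)
    _∨'_ : ∀ {A B} → ParOnly A → ParOnly B → ParOnly (A ∨' B)
    _⇒_  : ∀ {A B} → ParOnly A → ParOnly B → ParOnly (A ⇒ B)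

  data NNIL : Formula → Set where
    var  : ∀ x → NNIL (var x)
    par  : ∀ p → NNIL (par p)
    ⊥'   : NNIL ⊥'
    ⊤'   : NNIL ⊤'
    _∧'_ : ∀ {A B} → NNIL A → NNIL B → NNIL (A ∧' B)
    _∨'_ : ∀ {A B} → NNIL A → NNIL B → NNIL (A ∨' B)
    imp  : ∀ {B C} → ImpFree B → NNIL C → NNIL (B ⇒ C)

  NNILpar : Formula → Set
  NNILpar E = NNIL E × ParOnly E

  ⋀ : List Formula → Formula
  ⋀ = foldr _∧'_ ⊤'

  ⋁ : List Formula → Formula
  ⋁ = foldr _∨'_ ⊥'

  _[_] : Formula → Formula → Formula
  B [ par p ] = par p
  B [ ⊥' ]    = ⊥'
  B [ E ]     = B ⇒ E

  -- Axiom V data: premises is the list of pairs (E_i, F_i), i = 1..n,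
  -- and concl the list E_{n+1}, …, E_{n+m}.
  V-B : List (Formula × Formula) → Formula
  V-B ps = ⋀ (map (λ q → proj₁ q ⇒ proj₂ q) ps)

  V-C : List Formula → Formula
  V-C es = ⋁ es

  V-rhs : List (Formula × Formula) → List Formula → Formula
  V-rhs ps es = ⋁ (map (λ E → V-B ps [ E ]) (map proj₁ ps ++ es))

  infix 2 AR⊢_▷_
  data AR⊢_▷_ : Formula → Formula → Set where
    Ax   : ∀ {A B} → IPC⊢ (A ⇒ B) → AR⊢ A ▷ B
    V    : ∀ ps es → AR⊢ (V-B ps ⇒ V-C es) ▷ V-rhs ps es
    Conj : ∀ {A B C} → AR⊢ A ▷ B → AR⊢ A ▷ C → AR⊢ A ▷ (B ∧' C)
    Cut  : ∀ {A B C} → AR⊢ A ▷ B → AR⊢ B ▷ C → AR⊢ A ▷ C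
    Disj : ∀ {A B C} → AR⊢ B ▷ A → AR⊢ C ▷ A → AR⊢ (B ∨' C) ▷ A
    Mont : ∀ {A B} (p : Fin np) → AR⊢ A ▷ B → AR⊢ (par p ⇒ A) ▷ (par p ⇒ B)

{-# OPTIONS --safe #-}
module Submission where

open import Defs
open import Data.Nat using (ℕ)
open import Data.Fin using (Fin)
open import Data.List using ([]; _∷_; map; _++_)
open import Data.List.Relation.Binary.Subset.Propositional using (_⊆_)
open import Data.List.Relation.Binary.Subset.Propositional.Properties using (∷⁺ʳ)
open import Data.List.Relation.Unary.Any using (here; there)
open import Data.Product using (_,_; proj₁)
open import Relation.Binary.PropositionalEquality using (refl)

-- Call E Montagna-admissible if prefixing both sides with E preserves ▷.
-- Admissibility is invariant under IPC-equivalence, holds for ⊤, ⊥ and (by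
-- Mont) for parameters, and is closed under ∧ and ∨. Using
-- (D₁ ∧ D₂) → C ≡ D₁ → (D₂ → C) and (D₁ ∨ D₂) → C ≡ (D₁ → C) ∧ (D₂ → C),
-- every NNIL(par) formula is then reached once p → C is shown admissible
-- for admissible C. That is an induction on the derivation of A ▷ B; in
-- the Disj and V cases one applies V with the extra premise p → C, whose
-- new disjunct p is exactly what allows replacing p → C by C and calling
-- on the admissibility of C.

module _ (nv np : ℕ) where
  open Language nv np

  weaken : ∀ {Γ Δ A} → Γ ⊆ Δ → Γ ⊢ A → Δ ⊢ A
  weaken ρ (hyp i)    = hyp (ρ i)
  weaken ρ ⊤I         = ⊤I
  weaken ρ (⊥E d)     = ⊥E (weaken ρ d)
  weaken ρ (∧I d e)   = ∧I (weaken ρ d) (weaken ρ e)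
  weaken ρ (∧E₁ d)    = ∧E₁ (weaken ρ d)
  weaken ρ (∧E₂ d)    = ∧E₂ (weaken ρ d)
  weaken ρ (∨I₁ d)    = ∨I₁ (weaken ρ d)
  weaken ρ (∨I₂ d)    = ∨I₂ (weaken ρ d)
  weaken ρ (∨E d e f) = ∨E (weaken ρ d) (weaken (∷⁺ʳ _ ρ) e) (weaken (∷⁺ʳ _ ρ) f)
  weaken ρ (⇒I d)     = ⇒I (weaken (∷⁺ʳ _ ρ) d)
  weaken ρ (⇒E d e)   = ⇒E (weaken ρ d) (weaken ρ e)

  ⊢-from-IPC : ∀ {Γ A} → IPC⊢ A → Γ ⊢ A
  ⊢-from-IPC = weaken (λ ())

  #0 : ∀ {Γ A} → (A ∷ Γ) ⊢ A
  #0 = hyp (here refl)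

  #1 : ∀ {Γ A B} → (B ∷ A ∷ Γ) ⊢ A
  #1 = hyp (there (here refl))

  #2 : ∀ {Γ A B C} → (C ∷ B ∷ A ∷ Γ) ⊢ A
  #2 = hyp (there (there (here refl)))

  ▷-ipc : ∀ {A B} → (A ∷ []) ⊢ B → AR⊢ A ▷ B
  ▷-ipc d = Ax (⇒I d)

  ▷-resp-ipc : ∀ {A A′ B B′} → (A′ ∷ []) ⊢ A → (B ∷ []) ⊢ B′ →
               AR⊢ A ▷ B → AR⊢ A′ ▷ B′
  ▷-resp-ipc a b d = Cut (▷-ipc a) (Cut d (▷-ipc b))

  ⋁-mono-▷ : (f g : Formula → Formula) → (∀ X → AR⊢ f X ▷ g X) →
             ∀ Xs → AR⊢ ⋁ (map f Xs) ▷ ⋁ (map g Xs)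
  ⋁-mono-▷ f g f▷g []       = ▷-ipc #0
  ⋁-mono-▷ f g f▷g (X ∷ Xs) =
    Disj (Cut (f▷g X) (▷-ipc (∨I₁ #0))) (Cut (⋁-mono-▷ f g f▷g Xs) (▷-ipc (∨I₂ #0)))

  ⋁-⇒-▷-⇒-⋁ : ∀ E (h : Formula → Formula) Xs →
              AR⊢ ⋁ (map (λ X → E ⇒ h X) Xs) ▷ (E ⇒ ⋁ (map h Xs))
  ⋁-⇒-▷-⇒-⋁ E h []       = ▷-ipc (⊥E #0)
  ⋁-⇒-▷-⇒-⋁ E h (X ∷ Xs) =
    Disj (▷-ipc (⇒I (∨I₁ (⇒E #1 #0))))
         (Cut (⋁-⇒-▷-⇒-⋁ E h Xs) (▷-ipc (⇒I (∨I₂ (⇒E #1 #0)))))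

  []-▷-⇒ : ∀ W X → AR⊢ (W [ X ]) ▷ (W ⇒ X)
  []-▷-⇒ W (var x)   = ▷-ipc #0
  []-▷-⇒ W (par q)   = ▷-ipc (⇒I #1)
  []-▷-⇒ W ⊥'        = ▷-ipc (⇒I #1)
  []-▷-⇒ W ⊤'        = ▷-ipc #0
  []-▷-⇒ W (X ∧' Y)  = ▷-ipc #0
  []-▷-⇒ W (X ∨' Y)  = ▷-ipc #0
  []-▷-⇒ W (X ⇒ Y)   = ▷-ipc #0

  ∧-[]-▷-⇒-[] : ∀ E W X → AR⊢ ((E ∧' W) [ X ]) ▷ (E ⇒ (W [ X ]))
  ∧-[]-▷-⇒-[] E W (var x)  = ▷-ipc (⇒I (⇒I (⇒E #2 (∧I #1 #0))))
  ∧-[]-▷-⇒-[] E W (par q)  = ▷-ipc (⇒I #1)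
  ∧-[]-▷-⇒-[] E W ⊥'       = ▷-ipc (⇒I #1)
  ∧-[]-▷-⇒-[] E W ⊤'       = ▷-ipc (⇒I (⇒I (⇒E #2 (∧I #1 #0))))
  ∧-[]-▷-⇒-[] E W (X ∧' Y) = ▷-ipc (⇒I (⇒I (⇒E #2 (∧I #1 #0))))
  ∧-[]-▷-⇒-[] E W (X ∨' Y) = ▷-ipc (⇒I (⇒I (⇒E #2 (∧I #1 #0))))
  ∧-[]-▷-⇒-[] E W (X ⇒ Y)  = ▷-ipc (⇒I (⇒I (⇒E #2 (∧I #1 #0))))

  ⇒-swap-▷ : ∀ {X Y Z} → AR⊢ (X ⇒ (Y ⇒ Z)) ▷ (Y ⇒ (X ⇒ Z))
  ⇒-swap-▷ = ▷-ipc (⇒I (⇒I (⇒E (⇒E #2 #0) #1)))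

  MontAdmissible : Formula → Set
  MontAdmissible E = ∀ {A B} → AR⊢ A ▷ B → AR⊢ (E ⇒ A) ▷ (E ⇒ B)

  MontAdmissible-resp-ipc : ∀ {E E′} → IPC⊢ (E ⇒ E′) → IPC⊢ (E′ ⇒ E) →
                            MontAdmissible E → MontAdmissible E′
  MontAdmissible-resp-ipc E⇒E′ E′⇒E adm d =
    ▷-resp-ipc (⇒I (⇒E #1 (⇒E (⊢-from-IPC E⇒E′) #0)))
               (⇒I (⇒E #1 (⇒E (⊢-from-IPC E′⇒E) #0)))
               (adm d)

  MontAdmissible-⊤ : MontAdmissible ⊤'
  MontAdmissible-⊤ = ▷-resp-ipc (⇒E #0 ⊤I) (⇒I #1)

  MontAdmissible-⊥ : MontAdmissible ⊥'
  MontAdmissible-⊥ _ = ▷-ipc (⇒I (⊥E #0))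

  MontAdmissible-par : ∀ p → MontAdmissible (par p)
  MontAdmissible-par p = Mont p

  MontAdmissible-∧ : ∀ {E₁ E₂} → MontAdmissible E₁ → MontAdmissible E₂ →
                     MontAdmissible (E₁ ∧' E₂)
  MontAdmissible-∧ adm₁ adm₂ d =
    ▷-resp-ipc (⇒I (⇒I (⇒E #2 (∧I #1 #0))))
               (⇒I (⇒E (⇒E #1 (∧E₁ #0)) (∧E₂ #0)))
               (adm₁ (adm₂ d))

  MontAdmissible-∨ : ∀ {E₁ E₂} → MontAdmissible E₁ → MontAdmissible E₂ →
                     MontAdmissible (E₁ ∨' E₂)
  MontAdmissible-∨ adm₁ adm₂ d =
    Cut (Conj (Cut (▷-ipc (⇒I (⇒E #1 (∨I₁ #0)))) (adm₁ d))
              (Cut (▷-ipc (⇒I (⇒E #1 (∨I₂ #0)))) (adm₂ d)))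
        (▷-ipc (⇒I (∨E #0 (⇒E (∧E₁ #2) #0) (⇒E (∧E₂ #2) #0))))

  module ParImplication (p : Fin np) (C : Formula) (admC : MontAdmissible C) where

    E : Formula
    E = par p ⇒ C

    given-p : ∀ {A B} → AR⊢ A ▷ B → AR⊢ (par p ∧' (E ⇒ A)) ▷ (E ⇒ B)
    given-p d =
      Cut (Conj (▷-ipc (∧E₁ #0))
                (Cut (▷-ipc (⇒I (⇒E (∧E₂ #1) (⇒I #1)))) (admC d)))
          (▷-ipc (⇒I (⇒E (∧E₂ #1) (⇒E #0 (∧E₁ #1)))))

    split-on-p : ∀ {A B R} → AR⊢ (E ⇒ A) ▷ (par p ∨' R) → AR⊢ R ▷ (E ⇒ B) →
                 AR⊢ A ▷ B → AR⊢ (E ⇒ A) ▷ (E ⇒ B)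
    split-on-p p∨R R▷ d =
      Cut (Conj (▷-ipc #0) p∨R)
          (Cut (▷-ipc (∨E (∧E₂ #0) (∨I₁ (∧I #0 (∧E₁ #1))) (∨I₂ #0)))
               (Disj (given-p d) R▷))

    E∧⊤-[]-▷-E⇒ : ∀ X → AR⊢ ((E ∧' ⊤') [ X ]) ▷ (E ⇒ X)
    E∧⊤-[]-▷-E⇒ X = Cut ([]-▷-⇒ (E ∧' ⊤') X) (▷-ipc (⇒I (⇒E #1 (∧I #0 ⊤I))))

    admissible : MontAdmissible E
    admissible (Ax d) = ▷-ipc (⇒I (⇒E (⊢-from-IPC d) (⇒E #1 #0)))
    admissible (Conj d₁ d₂) =
      Cut (Conj (admissible d₁) (admissible d₂))
          (▷-ipc (⇒I (∧I (⇒E (∧E₁ #1) #0) (⇒E (∧E₂ #1) #0))))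
    admissible (Cut d₁ d₂) = Cut (admissible d₁) (admissible d₂)
    admissible (Mont q d) = Cut ⇒-swap-▷ (Cut (Mont q (admissible d)) ⇒-swap-▷)
    -- V with premises (p , C) ∷ ps has right side p ∨ …, since (E ∧ _) [ par p ] = par p.
    admissible (Disj {B = B₁} {C = B₂} d₁ d₂) =
      split-on-p
        (Cut (▷-ipc (⇒I (∨E (⇒E #1 (∧E₁ #0)) (∨I₁ #0) (∨I₂ (∨I₁ #0)))))
             (V ((par p , C) ∷ []) (B₁ ∷ B₂ ∷ [])))
        (Disj (Cut (E∧⊤-[]-▷-E⇒ B₁) (admissible d₁))
              (Disj (Cut (E∧⊤-[]-▷-E⇒ B₂) (admissible d₂)) (▷-ipc (⊥E #0))))
        (Disj d₁ d₂)
    admissible (V ps es) =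
      split-on-p
        (Cut (▷-ipc (⇒I (⇒E (⇒E #1 (∧E₁ #0)) (∧E₂ #0))))
             (V ((par p , C) ∷ ps) es))
        (Cut (⋁-mono-▷ (λ X → (E ∧' V-B ps) [ X ]) (λ X → E ⇒ (V-B ps [ X ]))
                       (∧-[]-▷-⇒-[] E (V-B ps)) Xs)
             (⋁-⇒-▷-⇒-⋁ E (λ X → V-B ps [ X ]) Xs))
        (V ps es)
      where Xs = map proj₁ ps ++ es

  MontAdmissible-⇒ : ∀ {D} → ImpFree D → ParOnly D →
                     ∀ {C} → MontAdmissible C → MontAdmissible (D ⇒ C)
  MontAdmissible-⇒ (var x) ()
  MontAdmissible-⇒ (par p) _ {C} admC = ParImplication.admissible p C admC
  MontAdmissible-⇒ ⊥' _ _ =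
    MontAdmissible-resp-ipc (⇒I (⇒I (⊥E #0))) (⇒I ⊤I) MontAdmissible-⊤
  MontAdmissible-⇒ ⊤' _ admC =
    MontAdmissible-resp-ipc (⇒I (⇒I #1)) (⇒I (⇒E #0 ⊤I)) admC
  MontAdmissible-⇒ (i₁ ∧' i₂) (o₁ ∧' o₂) admC =
    MontAdmissible-resp-ipc (⇒I (⇒I (⇒E (⇒E #1 (∧E₁ #0)) (∧E₂ #0))))
                            (⇒I (⇒I (⇒I (⇒E #2 (∧I #1 #0)))))
                            (MontAdmissible-⇒ i₁ o₁ (MontAdmissible-⇒ i₂ o₂ admC))
  MontAdmissible-⇒ (i₁ ∨' i₂) (o₁ ∨' o₂) admC =
    MontAdmissible-resp-ipc (⇒I (⇒I (∨E #0 (⇒E (∧E₁ #2) #0) (⇒E (∧E₂ #2) #0))))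
                            (⇒I (∧I (⇒I (⇒E #1 (∨I₁ #0))) (⇒I (⇒E #1 (∨I₂ #0)))))
                            (MontAdmissible-∧ (MontAdmissible-⇒ i₁ o₁ admC)
                                              (MontAdmissible-⇒ i₂ o₂ admC))

  MontAdmissible-NNILpar : ∀ {E} → NNIL E → ParOnly E → MontAdmissible E
  MontAdmissible-NNILpar (var x) ()
  MontAdmissible-NNILpar (par p) _ = MontAdmissible-par p
  MontAdmissible-NNILpar ⊥' _ = MontAdmissible-⊥
  MontAdmissible-NNILpar ⊤' _ = MontAdmissible-⊤
  MontAdmissible-NNILpar (n₁ ∧' n₂) (o₁ ∧' o₂) =
    MontAdmissible-∧ (MontAdmissible-NNILpar n₁ o₁) (MontAdmissible-NNILpar n₂ o₂)
  MontAdmissible-NNILpar (n₁ ∨' n₂) (o₁ ∨' o₂) =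
    MontAdmissible-∨ (MontAdmissible-NNILpar n₁ o₁) (MontAdmissible-NNILpar n₂ o₂)
  MontAdmissible-NNILpar (imp i n) (o₁ ⇒ o₂) =
    MontAdmissible-⇒ i o₁ (MontAdmissible-NNILpar n o₂)

corollary4p16 : (nv np : ℕ) → let open Language nv np in
    (A B E : Formula) → NNILpar E → AR⊢ A ▷ B → AR⊢ (E ⇒ A) ▷ (E ⇒ B)
corollary4p16 nv np A B E (nnil , parOnly) =
  MontAdmissible-NNILpar nv np nnil parOnly
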